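{- Let $\mathbf T$ be a countable homogeneous tournament with its fixed expansion $\mathbf T^*$ (described in the context), and let $n$ be a positive integer. If $\mathrm{Age}(\mathbf T^*)$ has the expansion property relative to $\mathrm{Age}(\mathbf T)$, then $\mathrm{Age}(\mathbf T[I_n]^*)$ has the expansion property relative to $\mathrm{Age}(\mathbf T[I_n])$.
   Context: A tournament is a directed graph with exactly one directed edge between any two distinct vertices; it is homogeneous if every isomorphism between finite substructures extends to an automorphism. The countable homogeneous tournaments are $I_1$ (one vertex), the 3-cycle $C_3$ on $\{0,1,2\}$, $\mathbb Q$ (with $E(x,y)$ iff $x<y$), the dense local order $\mathbf S(2)$ (a countable dense subset $D$ of the unit circle with no antipodal points and not containing the points at angles $\pi/2,3\pi/2$, with $E(x,y)$ iff the counterclockwise angle from $x$ to $y$ is in $(0,\pi)$), and the generic tournament $T^\omega$. Fixed expansions $\mathbf T^*$ (each containing $E$ and a binary symbol $<$ interpreted as a linear order $<^*$): $I_1^*$ adds one unary predicate true at its vertex; $C_3^*$ adds three unary predicates, the $i$-th true exactly at $i$, and a fixed linear order; $\mathbb Q^*$ adds the usual order; $\mathbf S(2)^*$ adds two unary predicates for the two halves of $D$ cut by the line through angles $\pi/2,3\pi/2$ and the order $x<y$ iff ($x,y$ in the same half and $E(x,y)$) or (different halves and $E(y,x)$); $T^{\omega*}$ is the Fraïssé limit of all finite linearly ordered tournaments. $\mathbf T[I_n]$ is the directed graph on $T\times[n]$ with $E((x,i),(y,j))$ iff $E^{\mathbf T}(x,y)$. $\mathbf T[I_n]^*$ expands it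 by: for each relation $R$ of $\mathbf T^*$ other than $E,<$, $R((x_1,i_1),\dots,(x_m,i_m))$ iff $R^{\mathbf T^*}(x_1,\dots,x_m)$; $(x,i)<(y,j)$ iff $x<^*y$ or ($x=y$ and $i<j$); unary predicates $L_i$ ($i\in[n]$) with $L_i(x,j)$ iff $j=i$. If $\mathcal K^*$ is a class of expansions of members of a class $\mathcal K$ (in a larger language $L^*\supseteq L$), $\mathcal K^*$ has the expansion property relative to $\mathcal K$ if for every $\mathbf A\in\mathcal K$ there is $\mathbf B\in\mathcal K$ such that for every $\mathbf A^*,\mathbf B^*\in\mathcal K^*$ whose $L$-reducts are $\mathbf A$ and $\mathbf B$ respectively, $\mathbf A^*$ embeds in $\mathbf B^*$. The age of a structure is the class of finite structures embeddable in it. -}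

module Defs where

open import Level using (0ℓ)
open import Data.Nat as ℕ using (ℕ; zero; suc; _%_; _≡ᵇ_)
open import Data.Fin as Fin using (Fin; toℕ)
open import Data.Bool using (Bool; true; false; T; if_then_else_; _∧_; not)
open import Data.Rational as ℚ using (ℚ; 0ℚ; 1ℚ; ½; _≤ᵇ_; _-_)
open import Data.Integer using (+_)
open import Data.Unit using (⊤)
open import Data.Empty using (⊥)
open import Data.Product using (Σ; ∃; _×_; _,_; proj₁)
open import Data.Sum using (_⊎_; inj₁; inj₂)
open import Relation.Nullary using (¬_)
open import Relation.Binary.PropositionalEquality using (_≡_; _≢_)
open import Function.Bundles using (_⇔_)

-- Structures in the language {E, <} ∪ {P u : u ∈ U}
-- (E binary "edge", Lt binary "<", P u unary predicates).

record Str (U : Set) : Set₁ where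
  field
    Car : Set
    E   : Car → Car → Set
    Lt  : Car → Car → Set
    P   : U → Car → Set
open Str public

IsTournament : (C : Set) → (C → C → Set) → Set
IsTournament C E =
  (∀ x → ¬ E x x) × (∀ x y → ¬ (E x y × E y x)) × (∀ x y → x ≢ y → E x y ⊎ E y x)

IsStrictLinearOrder : (C : Set) → (C → C → Set) → Set
IsStrictLinearOrder C R =
  (∀ x → ¬ R x x) × (∀ x y z → R x y → R y z → R x z) × (∀ x y → x ≢ y → R x y ⊎ R y x)

Injective : {A B : Set} → (A → B) → Set
Injective f = ∀ x y → f x ≡ f y → x ≡ y

-- Finite structures (every finite structure is, up to isomorphism, one on Fin k).

record FinDigraph : Set₁ where
  field
    size : ℕ
    FE   : Fin size → Fin size → Set
open FinDigraph public

record Expansion (U : Set) (A : FinDigraph) : Set₁ where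
  field
    XLt : Fin (size A) → Fin (size A) → Set
    XP  : U → Fin (size A) → Set
open Expansion public

IsEmbedD : {U : Set} (A : FinDigraph) (M : Str U) → (Fin (size A) → Car M) → Set
IsEmbedD A M f = Injective f × (∀ x y → FE A x y ⇔ E M (f x) (f y))

InAge : {U : Set} → Str U → FinDigraph → Set
InAge M A = Σ (Fin (size A) → Car M) (IsEmbedD A M)

IsEmbedX : {U : Set} (A : FinDigraph) (Ax : Expansion U A) (M : Str U)
         → (Fin (size A) → Car M) → Set
IsEmbedX {U} A Ax M f =
  IsEmbedD A M f
  × (∀ x y → XLt Ax x y ⇔ Lt M (f x) (f y))
  × (∀ (u : U) x → XP Ax u x ⇔ P M u (f x))

InAgeX : {U : Set} → Str U → (A : FinDigraph) → Expansion U A → Set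
InAgeX M A Ax = Σ (Fin (size A) → Car M) (IsEmbedX A Ax M)

EmbedsFin : {U : Set} (A : FinDigraph) → Expansion U A
          → (B : FinDigraph) → Expansion U B → Set
EmbedsFin {U} A Ax B Bx = Σ (Fin (size A) → Fin (size B)) λ f →
  Injective f
  × (∀ x y → FE A x y ⇔ FE B (f x) (f y))
  × (∀ x y → XLt Ax x y ⇔ XLt Bx (f x) (f y))
  × (∀ (u : U) x → XP Ax u x ⇔ XP Bx u (f x))

ExpansionProperty : {U : Set} → Str U → Set₁
ExpansionProperty {U} M =
  ∀ (A : FinDigraph) → InAge M A →
  Σ FinDigraph λ B → InAge M B ×
    (∀ (Ax : Expansion U A) (Bx : Expansion U B) →
       InAgeX M A Ax → InAgeX M B Bx → EmbedsFin A Ax B Bx)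

blowup : {U : Set} (n : ℕ) → Str U → Str (U ⊎ Fin n)
blowup n M = record
  { Car = Car M × Fin n
  ; E   = λ { (x , i) (y , j) → E M x y }
  ; Lt  = λ { (x , i) (y , j) → Lt M x y ⊎ (x ≡ y × i Fin.< j) }
  ; P   = λ { (inj₁ u) (x , i) → P M u x
            ; (inj₂ l) (x , i) → i ≡ l }
  }

I₁* : Str (Fin 1)
I₁* = record { Car = ⊤ ; E = λ _ _ → ⊥ ; Lt = λ _ _ → ⊥ ; P = λ _ _ → ⊤ }

C₃* : Str (Fin 3)
C₃* = record
  { Car = Fin 3
  ; E   = λ x y → (suc (toℕ x)) % 3 ≡ toℕ y
  ; Lt  = λ x y → toℕ x ℕ.< toℕ y
  ; P   = λ i x → x ≡ i
  }

ℚ* : Str ⊥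
ℚ* = record { Car = ℚ ; E = ℚ._<_ ; Lt = ℚ._<_ ; P = λ () }

-- A point of the circle at angle π·a is represented by a ∈ [0,2) ∩ ℚ.
-- D = { a ∈ ℚ : 0 ≤ a < 2, a ≠ 1/2, and (a < 1 iff the reduced denominator of a is even) }.
-- D is countable and dense; a and a+1 have the same reduced denominator, so D has no
-- antipodal points; 1/2 is excluded explicitly and 3/2 (denominator 2, ≥ 1) is excluded.
two : ℚ
two = + 2 ℚ./ 1

threeHalves : ℚ
threeHalves = + 3 ℚ./ 2

evenDen : ℚ → Bool
evenDen a = (ℚ.denominatorℕ a % 2) ≡ᵇ 0

inD : ℚ → Bool
inD a = (0ℚ ≤ᵇ a) ∧ not (two ≤ᵇ a) ∧ not ((a ≤ᵇ ½) ∧ (½ ≤ᵇ a))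
        ∧ (if 1ℚ ≤ᵇ a then not (evenDen a) else evenDen a)

D : Set
D = Σ ℚ (λ a → T (inD a))

-- counterclockwise angle from x to y (divided by π) lies in (0,1)
S2E : D → D → Set
S2E (a , _) (b , _) = (0ℚ ℚ.< b - a × b - a ℚ.< 1ℚ) ⊎ (b - a ℚ.< ℚ.- 1ℚ)

-- the two halves cut by the line through the angles π/2 and 3π/2
LeftHalf : D → Set
LeftHalf (a , _) = ½ ℚ.< a × a ℚ.< threeHalves

RightHalf : D → Set
RightHalf (a , _) = a ℚ.< ½ ⊎ threeHalves ℚ.< a

Half : Fin 2 → D → Set
Half Fin.zero    = LeftHalf
Half (Fin.suc _) = RightHalf

SameHalf : D → D → Set
SameHalf x y = (LeftHalf x × LeftHalf y) ⊎ (RightHalf x × RightHalf y)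

S2* : Str (Fin 2)
S2* = record
  { Car = D
  ; E   = S2E
  ; Lt  = λ x y → (SameHalf x y × S2E x y) ⊎ (¬ SameHalf x y × S2E y x)
  ; P   = Half
  }

-- T^ω* : the Fraïssé limit of all finite linearly ordered tournaments, characterised
-- (up to isomorphism, by Fraïssé's theorem) as a countable structure in the
-- language {E,<} which is a linearly ordered tournament, whose age consists of all
-- finite linearly ordered tournaments, and which is ultrahomogeneous.

OrderedTournamentFin : (A : FinDigraph) → Expansion ⊥ A → Set
OrderedTournamentFin A Ax = IsTournament (Fin (size A)) (FE A)
                          × IsStrictLinearOrder (Fin (size A)) (XLt Ax)

Countable : Set → Set
Countable C = Σ (ℕ → C) λ e → ∀ c → ∃ λ m → e m ≡ c

IsAutomorphism : {U : Set} (M : Str U) → (Car M → Car M) → Set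
IsAutomorphism {U} M σ =
  Injective σ × (∀ y → ∃ λ x → σ x ≡ y)
  × (∀ x y → E M x y ⇔ E M (σ x) (σ y))
  × (∀ x y → Lt M x y ⇔ Lt M (σ x) (σ y))
  × (∀ (u : U) x → P M u x ⇔ P M u (σ x))

-- every isomorphism between finite substructures extends to an automorphism:
-- finite substructures are images of injective f, g : Fin k → M, and f i ↦ g i
-- is an isomorphism of substructures.
Ultrahomogeneous : {U : Set} → Str U → Set
Ultrahomogeneous {U} M =
  ∀ (k : ℕ) (f g : Fin k → Car M) → Injective f → Injective g
  → (∀ i j → E M (f i) (f j) ⇔ E M (g i) (g j))
  → (∀ i j → Lt M (f i) (f j) ⇔ Lt M (g i) (g j))
  → (∀ (u : U) i → P M u (f i) ⇔ P M u (g i))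
  → Σ (Car M → Car M) λ σ → IsAutomorphism M σ × (∀ i → σ (f i) ≡ g i)

record IsGenericOrderedTournament (M : Str ⊥) : Set₁ where
  field
    countable  : Countable (Car M)
    tournament : IsTournament (Car M) (E M)
    linear     : IsStrictLinearOrder (Car M) (Lt M)
    universal  : ∀ (A : FinDigraph) (Ax : Expansion ⊥ A) →
                 OrderedTournamentFin A Ax → InAgeX M A Ax
    homogeneous : Ultrahomogeneous M

data HomTournament : Set₁ where
  I₁ C₃ ℚT S2 : HomTournament
  Tω : (M : Str ⊥) → IsGenericOrderedTournament M → HomTournament

Sig : HomTournament → Set
Sig I₁       = Fin 1
Sig C₃       = Fin 3
Sig ℚT       = ⊥
Sig S2       = Fin 2
Sig (Tω _ _) = ⊥

_* : (T : HomTournament) → Str (Sig T)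
I₁ *       = I₁*
C₃ *       = C₃*
ℚT *       = ℚ*
S2 *       = S2*
(Tω M _) * = M

-- Write M[n] for the blow-up of a structure M, in which every point of M is
-- replaced by an independent set of n points ordered lexicographically and
-- labelled by L₁,…,Lₙ.  The argument only uses that the E-reduct of M is a
-- tournament with decidable equality; every fixed expansion T* is of this kind.
--
-- Given A in Age(M[n]), collapse every fibre to get its shadow A₀ ∈ Age(M) and
-- let B₀ be the witness of the expansion property of M for A₀; the witness for A
-- is B = B₀[n].  For expansions A*, B* realised in M[n], a realisation of B
-- maps every fibre of B₀[n] bijectively onto a fibre of M[n] (a fibre has no
-- edges, and an edgeless set in a tournament is a single point), so B*
-- restricted to one point per fibre (here n ≥ 1 is used) is an expansion B₀*
-- of B₀, and A* induces an expansion A₀* of A₀.  An embedding A₀* → B₀* then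
-- lifts to A* → B*: send a point of A to the point of the corresponding fibre
-- of B carrying the same label.
module Submission where

open import Defs
open import Data.Nat using (ℕ; zero; suc; _≤_)
import Data.Nat as ℕ
import Data.Nat.Properties as ℕP
open import Data.Nat.Divisibility using (_∣_; m%n≡0⇒n∣m; n∣m⇒m%n≡0; ∣m+n∣m⇒∣n; ∣n⇒∣m*n)
open import Data.Nat.Primality using (prime[2]; euclidsLemma)
open import Data.Nat.Coprimality using (Coprime; coprime?)
open import Data.Fin using (Fin; zero; suc; combine; quotient; remainder; punchOut)
import Data.Fin as Fin
import Data.Fin.Properties as FinP
open import Data.Integer using (+_; -[1+_])
import Data.Integer as ℤ
import Data.Integer.Properties as ℤP
open import Data.Rational using (ℚ; mkℚ; 0ℚ; 1ℚ; ½; _≤ᵇ_; _-_)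
import Data.Rational as ℚ
import Data.Rational.Properties as ℚP
import Data.Rational.Unnormalised as ℚᵘ
import Data.Rational.Unnormalised.Properties as ℚᵘP
open import Algebra.Properties.AbelianGroup ℚP.+-0-abelianGroup
  using (//-rightDividesˡ; x∙y⁻¹≈ε⇒x≈y; ⁻¹-anti-homo‿-)
open import Data.Bool using (Bool; true; false; T; not; _∧_; if_then_else_)
open import Data.Bool.Properties using (T-∧; T-irrelevant)
open import Data.Product using (∃; _×_; _,_; proj₁; proj₂)
open import Data.Sum using (_⊎_; inj₁; inj₂; swap)
open import Data.Empty using (⊥; ⊥-elim)
open import Function using (_∘_)
open import Function.Bundles using (_⇔_; mk⇔; Equivalence)
import Function.Properties.Equivalence as ⇔
open import Function.Related.Propositional using (module EquationalReasoning)
open import Relation.Nullary using (¬_; yes; no)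
open import Relation.Nullary.Decidable using (recompute)
open import Relation.Binary.Definitions using (DecidableEquality; tri<; tri≈; tri>)
open import Relation.Binary.PropositionalEquality

open Equivalence using (to; from)

≡⇒⇔ : {A B : Set} → A ≡ B → A ⇔ B
≡⇒⇔ refl = ⇔.refl

-- An injective endomap of a finite set is surjective (pigeonhole principle):
-- if σ missed t it would inject Fin (suc n) into Fin n after deleting t.
injective⇒surjective : ∀ {n} (σ : Fin n → Fin n) → Injective σ → ∀ t → ∃ λ l → σ l ≡ t
injective⇒surjective {zero} σ σ-inj ()
injective⇒surjective {suc n} σ σ-inj t with FinP.any? (λ l → σ l FinP.≟ t)
... | yes hit = hit
... | no miss = ⊥-elim (no-collision (FinP.pigeonhole (ℕP.n<1+n n) (λ l → punchOut (missed l))))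
  where
    missed : ∀ l → t ≢ σ l
    missed l t≡σl = miss (l , sym t≡σl)

    no-collision : ¬ ∃ λ i → ∃ λ j → i Fin.< j × punchOut (missed i) ≡ punchOut (missed j)
    no-collision (i , j , i<j , collide) =
      FinP.<-irrefl (σ-inj i j (FinP.punchOut-injective (missed i) (missed j) collide)) i<j

record ImageEnumeration {X : Set} {k : ℕ} (g : Fin k → X) : Set where
  field
    card          : ℕ
    rep           : Fin card → Fin k
    cls           : Fin k → Fin card
    rep-injective : Injective (g ∘ rep)
    rep-cls       : ∀ x → g (rep (cls x)) ≡ g x

-- With decidable equality every finite image can be enumerated: g 0 is either
-- already in the enumeration of the image of g ∘ suc, or is added as a new point.
enumerateImage : {X : Set} → DecidableEquality X → ∀ {k} (g : Fin k → X) → ImageEnumeration g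
enumerateImage _≟_ {zero} g = record
  { card = 0 ; rep = λ () ; cls = λ () ; rep-injective = λ () ; rep-cls = λ () }
enumerateImage _≟_ {suc k} g
  with enum ← enumerateImage _≟_ (g ∘ suc)
  with FinP.any? (λ a → g (suc (ImageEnumeration.rep enum a)) ≟ g zero)
... | yes (a , g0-seen) = record
  { card          = card
  ; rep           = suc ∘ rep
  ; cls           = λ { zero → a ; (suc x) → cls x }
  ; rep-injective = rep-injective
  ; rep-cls       = λ { zero → g0-seen ; (suc x) → rep-cls x }
  }
  where open ImageEnumeration enum
... | no g0-new = record
  { card          = suc card
  ; rep           = rep′
  ; cls           = λ { zero → zero ; (suc x) → suc (cls x) }
  ; rep-injective = rep′-injective
  ; rep-cls       = λ { zero → refl ; (suc x) → rep-cls x }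
  }
  where
    open ImageEnumeration enum

    rep′ : Fin (suc card) → Fin (suc k)
    rep′ zero    = zero
    rep′ (suc a) = suc (rep a)

    rep′-injective : Injective (g ∘ rep′)
    rep′-injective zero    zero    _     = refl
    rep′-injective zero    (suc b) g0≡gb = ⊥-elim (g0-new (b , sym g0≡gb))
    rep′-injective (suc a) zero    ga≡g0 = ⊥-elim (g0-new (a , ga≡g0))
    rep′-injective (suc a) (suc b) ga≡gb = cong suc (rep-injective a b ga≡gb)

-- The E-reduct of M is a tournament with decidable equality.
record TournamentReduct {U : Set} (M : Str U) : Set where
  field
    _≟_         : DecidableEquality (Car M)
    irreflexive : ∀ x → ¬ E M x x
    total       : ∀ x y → x ≢ y → E M x y ⊎ E M y x

module _ {U : Set} {M : Str U} (tournament : TournamentReduct M) where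
  open TournamentReduct tournament

  non-adjacent⇒equal : ∀ x y → ¬ E M x y → ¬ E M y x → x ≡ y
  non-adjacent⇒equal x y ¬xy ¬yx with x ≟ y
  ... | yes x≡y = x≡y
  ... | no x≢y with total x y x≢y
  ...   | inj₁ xy = ⊥-elim (¬xy xy)
  ...   | inj₂ yx = ⊥-elim (¬yx yx)

  -- The E-type of a family of points determines which of them coincide:
  -- equal points are exactly those joined by no edge.
  E-type-determines-kernel : {I : Set} (p q : I → Car M)
    → (∀ x y → E M (p x) (p y) ⇔ E M (q x) (q y))
    → ∀ x y → p x ≡ p y → q x ≡ q y
  E-type-determines-kernel p q same-E x y px≡py = non-adjacent⇒equal (q x) (q y)
    (λ qxy → irreflexive (p y) (subst (λ w → E M w (p y)) px≡py (from (same-E x y) qxy)))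
    (λ qyx → irreflexive (p y) (subst (E M (p y)) px≡py (from (same-E y x) qyx)))

  E-preserving-injective : (A : FinDigraph) → InAge M A → (p : Fin (size A) → Car M)
    → (∀ x y → FE A x y ⇔ E M (p x) (p y)) → Injective p
  E-preserving-injective A (q , q-inj , qE) p pE x y px≡py =
    q-inj x y (E-type-determines-kernel p q (λ x y → ⇔.trans (⇔.sym (pE x y)) (qE x y)) x y px≡py)

-- B[n]: every point b of B is replaced by the fibre {combine b l : l < n}, and
-- edges only depend on the fibres.
blowupFin : ℕ → FinDigraph → FinDigraph
blowupFin n B = record { size = size B ℕ.* n ; FE = λ u v → FE B (quotient n u) (quotient n v) }

quotient-combine : ∀ {m n} (b : Fin m) (l : Fin n) → quotient n (combine b l) ≡ b
quotient-combine b l = cong proj₁ (FinP.remQuot-combine b l)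

blowupFin-FE : ∀ {n} (B : FinDigraph) a (l : Fin n) b (l′ : Fin n)
  → FE (blowupFin n B) (combine a l) (combine b l′) ⇔ FE B a b
blowupFin-FE B a l b l′ = ≡⇒⇔ (cong₂ (FE B) (quotient-combine a l) (quotient-combine b l′))

blowup-inAge : ∀ {U} {M : Str U} n (B : FinDigraph) → InAge M B → InAge (blowup n M) (blowupFin n B)
blowup-inAge {M = M} n B (h , h-inj , hE) = h′ , h′-inj , λ u v → hE (fibre u) (fibre v)
  where
    fibre : Fin (size B ℕ.* n) → Fin (size B)
    fibre = quotient n

    label : Fin (size B ℕ.* n) → Fin n
    label = remainder {size B} n

    h′ : Fin (size B ℕ.* n) → Car M × Fin n
    h′ u = h (fibre u) , label u

    h′-inj : Injective h′
    h′-inj u v h′u≡h′v = begin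
      u                              ≡⟨ FinP.combine-remQuot {size B} n u ⟨
      combine (fibre u) (label u)    ≡⟨ cong₂ combine (h-inj _ _ (cong proj₁ h′u≡h′v)) (cong proj₂ h′u≡h′v) ⟩
      combine (fibre v) (label v)    ≡⟨ FinP.combine-remQuot {size B} n v ⟩
      v                              ∎
      where open ≡-Reasoning

blowup-Lt-transfer : ∀ {U} {M : Str U} {n} {I : Set} (p q : I → Car M)
  → Injective p → Injective q → (∀ a b → Lt M (p a) (p b) ⇔ Lt M (q a) (q b))
  → ∀ a b (i j : Fin n) → Lt (blowup n M) (p a , i) (p b , j) ⇔ Lt (blowup n M) (q a , i) (q b , j)
blowup-Lt-transfer p q p-inj q-inj same-Lt a b i j = mk⇔
  (λ { (inj₁ pa<pb) → inj₁ (to (same-Lt a b) pa<pb)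
     ; (inj₂ (pa≡pb , i<j)) → inj₂ (cong q (p-inj a b pa≡pb) , i<j) })
  (λ { (inj₁ qa<qb) → inj₁ (from (same-Lt a b) qa<qb)
     ; (inj₂ (qa≡qb , i<j)) → inj₂ (cong p (q-inj a b qa≡qb) , i<j) })

blowup-P-transfer : ∀ {U} {M : Str U} {n} (x y : Car M) → (∀ u → P M u x ⇔ P M u y)
  → ∀ u (i : Fin n) → P (blowup n M) u (x , i) ⇔ P (blowup n M) u (y , i)
blowup-P-transfer x y same-P (inj₁ u) i = same-P u
blowup-P-transfer x y same-P (inj₂ l) i = ⇔.refl

induced : ∀ {U} (M : Str U) (A : FinDigraph) → (Fin (size A) → Car M) → Expansion U A
induced M A h = record { XLt = λ a b → Lt M (h a) (h b) ; XP = λ u a → P M u (h a) }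

induced-realised : ∀ {U} {M : Str U} (A : FinDigraph) (h : Fin (size A) → Car M)
  → IsEmbedD A M h → InAgeX M A (induced M A h)
induced-realised A h h-emb = h , h-emb , (λ a b → ⇔.refl) , (λ u a → ⇔.refl)

module _ {U : Set} {M : Str U} (tournament : TournamentReduct M) {n : ℕ} (z : Fin n) where
  open TournamentReduct tournament using (_≟_; irreflexive)

  Mₙ : Str (U ⊎ Fin n)
  Mₙ = blowup n M

  -- An E-embedding hb of B₀[n] into M[n] maps every fibre of B₀[n] bijectively
  -- onto a fibre of M[n], namely the one over base b.
  module Fibres (B₀ : FinDigraph) (hb : Fin (size B₀ ℕ.* n) → Car M × Fin n)
                (hb-emb : IsEmbedD (blowupFin n B₀) Mₙ hb) where

    base : Fin (size B₀) → Car M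
    base b = proj₁ (hb (combine b z))

    -- A loop at b in B₀ would be a loop at base b, so fibres of B₀[n] are
    -- independent sets, and an independent set of a tournament is a point.
    fibre-constant : ∀ b l l′ → proj₁ (hb (combine b l)) ≡ proj₁ (hb (combine b l′))
    fibre-constant b l l′ = non-adjacent⇒equal tournament _ _ (no-edge l l′) (no-edge l′ l)
      where
        no-loop : ¬ FE B₀ b b
        no-loop loop = irreflexive _
          (to (proj₂ hb-emb (combine b z) (combine b z)) (from (blowupFin-FE B₀ b z b z) loop))

        no-edge : ∀ l l′ → ¬ E M (proj₁ (hb (combine b l))) (proj₁ (hb (combine b l′)))
        no-edge l l′ edge = no-loop (to (blowupFin-FE B₀ b l b l′) (from (proj₂ hb-emb _ _) edge))

    -- Hence, by injectivity of hb, the labels within a fibre are pairwise distinct.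
    label-injective : ∀ b → Injective (λ l → proj₂ (hb (combine b l)))
    label-injective b l l′ same-label = proj₂ (FinP.combine-injective b l b l′
      (proj₁ hb-emb _ _ (cong₂ _,_ (fibre-constant b l l′) same-label)))

    -- The point in the fibre of b whose image carries the label t.
    hit : Fin (size B₀) → Fin n → Fin (size B₀ ℕ.* n)
    hit b t = combine b (proj₁ (injective⇒surjective _ (label-injective b) t))

    hb-hit : ∀ b t → hb (hit b t) ≡ (base b , t)
    hb-hit b t = cong₂ _,_ (fibre-constant b _ z) (proj₂ (injective⇒surjective _ (label-injective b) t))

    quotient-hit : ∀ b t → quotient n (hit b t) ≡ b
    quotient-hit b t = quotient-combine b _

    base-E : ∀ a b → FE B₀ a b ⇔ E M (base a) (base b)
    base-E a b = ⇔.trans (⇔.sym (blowupFin-FE B₀ a z b z)) (proj₂ hb-emb (combine a z) (combine b z))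

  -- The shadow of f : A → M[n]: the image of the first coordinate g of f,
  -- enumerated without repetitions, with the edges of M.
  module Shadow (A : FinDigraph) (f : Fin (size A) → Car M × Fin n) where

    g : Fin (size A) → Car M
    g = proj₁ ∘ f

    open ImageEnumeration (enumerateImage _≟_ g) public

    shadow : FinDigraph
    shadow = record { size = card ; FE = λ a b → E M (g (rep a)) (g (rep b)) }

    shadow-inAge : InAge M shadow
    shadow-inAge = g ∘ rep , rep-injective , λ a b → ⇔.refl

  module Lift (A : FinDigraph) (f : Fin (size A) → Car M × Fin n)
              (fE : ∀ x y → FE A x y ⇔ E Mₙ (f x) (f y))
              (B₀ : FinDigraph) (B₀-inAge : InAge M B₀)
              {Ax : Expansion (U ⊎ Fin n) A} {Bx : Expansion (U ⊎ Fin n) (blowupFin n B₀)}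
              (ha : Fin (size A) → Car M × Fin n) (ha-emb : IsEmbedX A Ax Mₙ ha)
              (hb : Fin (size B₀ ℕ.* n) → Car M × Fin n)
              (hb-emb : IsEmbedX (blowupFin n B₀) Bx Mₙ hb) where
    open Shadow A f
    open Fibres B₀ hb (proj₁ hb-emb)

    -- f and ha are E-embeddings of the same A, so their first coordinates have
    -- the same E-type and hence identify the same points.
    same-E : ∀ x y → E M (g x) (g y) ⇔ E M (proj₁ (ha x)) (proj₁ (ha y))
    same-E x y = ⇔.trans (⇔.sym (fE x y)) (proj₂ (proj₁ ha-emb) x y)

    ha₀ : Fin card → Car M
    ha₀ a = proj₁ (ha (rep a))

    ha-factor : ∀ x → ha x ≡ (ha₀ (cls x) , proj₂ (ha x))
    ha-factor x = cong (_, proj₂ (ha x))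
      (E-type-determines-kernel tournament g (proj₁ ∘ ha) same-E x (rep (cls x)) (sym (rep-cls x)))

    ha₀-E : ∀ a b → FE shadow a b ⇔ E M (ha₀ a) (ha₀ b)
    ha₀-E a b = same-E (rep a) (rep b)

    ha₀-inj : Injective ha₀
    ha₀-inj = E-preserving-injective tournament shadow shadow-inAge ha₀ ha₀-E

    base-inj : Injective base
    base-inj = E-preserving-injective tournament B₀ B₀-inAge base base-E

    shadow* : Expansion U shadow
    shadow* = induced M shadow ha₀

    shadow*-realised : InAgeX M shadow shadow*
    shadow*-realised = induced-realised {M = M} shadow ha₀ (ha₀-inj , ha₀-E)

    B₀* : Expansion U B₀
    B₀* = induced M B₀ base

    B₀*-realised : InAgeX M B₀ B₀*
    B₀*-realised = induced-realised {M = M} B₀ base (base-inj , base-E)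

    -- A point x of A is sent into the fibre over F₀ (cls x), at the point
    -- whose image carries the same label as ha x; so hb ∘ F is ha with its
    -- first coordinate moved along F₀.
    lift : EmbedsFin shadow shadow* B₀ B₀* → EmbedsFin A Ax (blowupFin n B₀) Bx
    lift (F₀ , F₀-inj , F₀-E , F₀-Lt , F₀-P) = F , F-inj , F-E , F-Lt , F-P
      where
        F : Fin (size A) → Fin (size B₀ ℕ.* n)
        F x = hit (F₀ (cls x)) (proj₂ (ha x))

        hb-F : ∀ x → hb (F x) ≡ (base (F₀ (cls x)) , proj₂ (ha x))
        hb-F x = hb-hit _ _

        F-inj : Injective F
        F-inj x y Fx≡Fy = proj₁ (proj₁ ha-emb) x y (begin
          ha x                            ≡⟨ ha-factor x ⟩
          (ha₀ (cls x) , proj₂ (ha x))    ≡⟨ cong₂ _,_ (cong ha₀ same-class) (cong proj₂ same-image) ⟩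
          (ha₀ (cls y) , proj₂ (ha y))    ≡⟨ ha-factor y ⟨
          ha y                            ∎)
          where
            open ≡-Reasoning
            same-image : (base (F₀ (cls x)) , proj₂ (ha x)) ≡ (base (F₀ (cls y)) , proj₂ (ha y))
            same-image = trans (sym (hb-F x)) (trans (cong hb Fx≡Fy) (hb-F y))

            same-class : cls x ≡ cls y
            same-class = F₀-inj _ _ (base-inj _ _ (cong proj₁ same-image))

        F-E : ∀ x y → FE A x y ⇔ FE (blowupFin n B₀) (F x) (F y)
        F-E x y = begin
          FE A x y                           ∼⟨ fE x y ⟩
          E M (g x) (g y)                    ≡⟨ cong₂ (E M) (rep-cls x) (rep-cls y) ⟨
          FE shadow (cls x) (cls y)          ∼⟨ F₀-E (cls x) (cls y) ⟩
          FE B₀ (F₀ (cls x)) (F₀ (cls y))    ≡⟨ cong₂ (FE B₀) (quotient-hit _ _) (quotient-hit _ _) ⟨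
          FE (blowupFin n B₀) (F x) (F y)    ∎
          where open EquationalReasoning

        F-Lt : ∀ x y → XLt Ax x y ⇔ XLt Bx (F x) (F y)
        F-Lt x y = begin
          XLt Ax x y                                                      ∼⟨ proj₁ (proj₂ ha-emb) x y ⟩
          Lt Mₙ (ha x) (ha y)                                             ≡⟨ cong₂ (Lt Mₙ) (ha-factor x) (ha-factor y) ⟩
          Lt Mₙ (ha₀ (cls x) , proj₂ (ha x)) (ha₀ (cls y) , proj₂ (ha y))
            ∼⟨ blowup-Lt-transfer {M = M} ha₀ (base ∘ F₀) ha₀-inj (λ a b → F₀-inj a b ∘ base-inj _ _) F₀-Lt
                 (cls x) (cls y) (proj₂ (ha x)) (proj₂ (ha y)) ⟩
          Lt Mₙ (base (F₀ (cls x)) , proj₂ (ha x)) (base (F₀ (cls y)) , proj₂ (ha y))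
                                                                          ≡⟨ cong₂ (Lt Mₙ) (hb-F x) (hb-F y) ⟨
          Lt Mₙ (hb (F x)) (hb (F y))                                     ∼⟨ ⇔.sym (proj₁ (proj₂ hb-emb) (F x) (F y)) ⟩
          XLt Bx (F x) (F y)                                              ∎
          where open EquationalReasoning

        F-P : ∀ u x → XP Ax u x ⇔ XP Bx u (F x)
        F-P u x = begin
          XP Ax u x                                     ∼⟨ proj₂ (proj₂ ha-emb) u x ⟩
          P Mₙ u (ha x)                                 ≡⟨ cong (P Mₙ u) (ha-factor x) ⟩
          P Mₙ u (ha₀ (cls x) , proj₂ (ha x))           ∼⟨ blowup-P-transfer {M = M} _ _ (λ u → F₀-P u (cls x)) u _ ⟩
          P Mₙ u (base (F₀ (cls x)) , proj₂ (ha x))     ≡⟨ cong (P Mₙ u) (hb-F x) ⟨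
          P Mₙ u (hb (F x))                             ∼⟨ ⇔.sym (proj₂ (proj₂ hb-emb) u (F x)) ⟩
          XP Bx u (F x)                                 ∎
          where open EquationalReasoning

  blowup-preserves-EP : ExpansionProperty M → ExpansionProperty Mₙ
  blowup-preserves-EP ep A (f , _ , fE) with ep (Shadow.shadow A f) (Shadow.shadow-inAge A f)
  ... | B₀ , B₀-inAge , embed₀ =
    blowupFin n B₀ , blowup-inAge {M = M} n B₀ B₀-inAge ,
    λ Ax Bx (ha , ha-emb) (hb , hb-emb) →
      let open Lift A f fE B₀ B₀-inAge ha ha-emb hb hb-emb
      in lift (embed₀ shadow* B₀* shadow*-realised B₀*-realised)

I₁-tournament : TournamentReduct I₁*
I₁-tournament = record
  { _≟_ = λ _ _ → yes refl ; irreflexive = λ _ () ; total = λ _ _ x≢y → ⊥-elim (x≢y refl) }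

C₃-tournament : TournamentReduct C₃*
C₃-tournament = record { _≟_ = FinP._≟_ ; irreflexive = irreflexive ; total = total }
  where
    irreflexive : ∀ x → ¬ E C₃* x x
    irreflexive zero             ()
    irreflexive (suc zero)       ()
    irreflexive (suc (suc zero)) ()

    total : ∀ x y → x ≢ y → E C₃* x y ⊎ E C₃* y x
    total zero             (suc zero)       _ = inj₁ refl
    total zero             (suc (suc zero)) _ = inj₂ refl
    total (suc zero)       zero             _ = inj₂ refl
    total (suc zero)       (suc (suc zero)) _ = inj₁ refl
    total (suc (suc zero)) zero             _ = inj₁ refl
    total (suc (suc zero)) (suc zero)       _ = inj₂ refl
    total zero             zero             x≢x = ⊥-elim (x≢x refl)
    total (suc zero)       (suc zero)       x≢x = ⊥-elim (x≢x refl)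
    total (suc (suc zero)) (suc (suc zero)) x≢x = ⊥-elim (x≢x refl)

ℚ-tournament : TournamentReduct ℚ*
ℚ-tournament = record { _≟_ = ℚP._≟_ ; irreflexive = λ x → ℚP.<-irrefl refl ; total = total }
  where
    total : ∀ x y → x ≢ y → x ℚ.< y ⊎ y ℚ.< x
    total x y x≢y with ℚP.<-cmp x y
    ... | tri< x<y _ _   = inj₁ x<y
    ... | tri≈ _ x≡y _   = ⊥-elim (x≢y x≡y)
    ... | tri> _ _ y<x   = inj₂ y<x

-- A countable set has decidable equality: compare indices of enumeration.
countable⇒decEq : {C : Set} → Countable C → DecidableEquality C
countable⇒decEq (e , onto) x y with proj₁ (onto x) ℕP.≟ proj₁ (onto y)
... | yes same-index = yes (trans (sym (proj₂ (onto x))) (trans (cong e same-index) (proj₂ (onto y))))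
... | no  diff-index = no (λ x≡y → diff-index (cong (proj₁ ∘ onto) x≡y))

-- The generic ordered tournament is countable, hence has decidable equality.
Tω-tournament : (M : Str ⊥) → IsGenericOrderedTournament M → TournamentReduct M
Tω-tournament M generic = record
  { _≟_ = countable⇒decEq countable ; irreflexive = proj₁ tournament ; total = proj₂ (proj₂ tournament) }
  where open IsGenericOrderedTournament generic

-- The local order S(2).  Its tournament property amounts to D containing no
-- antipodal points a, a + 1, which rests on a parity argument on denominators.

-- If p/q is in lowest terms with q even, then p/q + 1 = r/s forces s even:
-- from rq = (p + q)s, an odd s would give 2 ∣ p + q, hence 2 ∣ p.
even-denominator-shift : ∀ p q r s → Coprime p q → 2 ∣ q → r ℕ.* q ≡ (p ℕ.+ q) ℕ.* s → 2 ∣ s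
even-denominator-shift p q r s coprime 2∣q cross
  with euclidsLemma (p ℕ.+ q) s prime[2] (subst (2 ∣_) cross (∣n⇒∣m*n r 2∣q))
... | inj₂ 2∣s   = 2∣s
... | inj₁ 2∣p+q = ⊥-elim (2≢1 (coprime (2∣p , 2∣q)))
  where
    2∣p : 2 ∣ p
    2∣p = ∣m+n∣m⇒∣n (subst (2 ∣_) (ℕP.+-comm p q) 2∣p+q) 2∣q

    2≢1 : 2 ≢ 1
    2≢1 ()

plus-one-cross : ∀ p d r e .(c : Coprime p (suc d)) .(c′ : Coprime r (suc e))
  → mkℚ (+ r) e c′ ≡ mkℚ (+ p) d c ℚ.+ 1ℚ → r ℕ.* suc d ≡ (p ℕ.+ suc d) ℕ.* suc e
plus-one-cross p d r e c c′ b≡a+1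
  with ℚᵘP.≃-trans (ℚP.toℚᵘ-cong b≡a+1) (ℚP.toℚᵘ-homo-+ (mkℚ (+ p) d c) 1ℚ)
... | ℚᵘ.*≡* cross = ℤP.+-injective (begin
  + (r ℕ.* suc d)                                ≡⟨ ℤP.pos-* r (suc d) ⟩
  + r ℤ.* + suc d                                ≡⟨ cong (λ k → + r ℤ.* + suc k) (ℕP.*-identityʳ d) ⟨
  + r ℤ.* + suc (d ℕ.* 1)                        ≡⟨ cross ⟩
  (+ p ℤ.* + 1 ℤ.+ + suc (d ℕ.+ 0)) ℤ.* + suc e
    ≡⟨ cong₂ (λ a k → (a ℤ.+ + suc k) ℤ.* + suc e) (ℤP.*-identityʳ (+ p)) (ℕP.+-identityʳ d) ⟩
  (+ p ℤ.+ + suc d) ℤ.* + suc e                  ≡⟨ ℤP.pos-* (p ℕ.+ suc d) (suc e) ⟨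
  + ((p ℕ.+ suc d) ℕ.* suc e)                    ∎)
  where open ≡-Reasoning

record InD (a : ℚ) : Set where
  field
    nonnegative : 0ℚ ℚ.≤ a
    below-two   : ¬ two ℚ.≤ a
    upper-odd   : 1ℚ ℚ.≤ a → ¬ 2 ∣ ℚ.denominatorℕ a
    lower-even  : ¬ 1ℚ ℚ.≤ a → 2 ∣ ℚ.denominatorℕ a

inD-conjuncts : ∀ a → T (inD a)
  → T (0ℚ ≤ᵇ a) × T (not (two ≤ᵇ a))
  × (T (1ℚ ≤ᵇ a) → T (not (evenDen a))) × (¬ T (1ℚ ≤ᵇ a) → T (evenDen a))
inD-conjuncts a a∈D =
  let 0≤a , rest₁ = split (0ℚ ≤ᵇ a) (not (two ≤ᵇ a) ∧ excludes-½ ∧ parity-bit) a∈D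
      a<2 , rest₂ = split (not (two ≤ᵇ a)) (excludes-½ ∧ parity-bit) rest₁
  in 0≤a , a<2 , T-if (1ℚ ≤ᵇ a) (not (evenDen a)) (evenDen a) (proj₂ (split excludes-½ parity-bit rest₂))
  where
    split : ∀ x y → T (x ∧ y) → T x × T y
    split x y = to (T-∧ {x} {y})

    T-if : ∀ c x y → T (if c then x else y) → (T c → T x) × (¬ T c → T y)
    T-if true  x y t = (λ _ → t) , (λ ¬true → ⊥-elim (¬true _))
    T-if false x y t = (λ ()) , (λ _ → t)

    excludes-½ : Bool
    excludes-½ = not ((a ≤ᵇ ½) ∧ (½ ≤ᵇ a))

    parity-bit : Bool
    parity-bit = if 1ℚ ≤ᵇ a then not (evenDen a) else evenDen a

inD⇒InD : ∀ a → T (inD a) → InD a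
inD⇒InD a a∈D with inD-conjuncts a a∈D
... | 0≤a , a<2 , upper , lower = record
  { nonnegative = ℚP.≤ᵇ⇒≤ 0≤a
  ; below-two   = not-both (two ≤ᵇ a) a<2 ∘ ℚP.≤⇒≤ᵇ
  ; upper-odd   = λ 1≤a 2∣den → not-both (evenDen a) (upper (ℚP.≤⇒≤ᵇ 1≤a)) (even⇐ 2∣den)
  ; lower-even  = λ a≱1 → even⇒ (lower (a≱1 ∘ ℚP.≤ᵇ⇒≤))
  }
  where
    not-both : ∀ b → T (not b) → ¬ T b
    not-both true  () _
    not-both false _  ()

    even⇒ : T (evenDen a) → 2 ∣ ℚ.denominatorℕ a
    even⇒ t = m%n≡0⇒n∣m _ 2 (ℕP.≡ᵇ⇒≡ _ 0 t)

    even⇐ : 2 ∣ ℚ.denominatorℕ a → T (evenDen a)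
    even⇐ 2∣den = ℕP.≡⇒≡ᵇ _ 0 (n∣m⇒m%n≡0 _ 2 2∣den)

-- D contains no antipodal points: if b = a + 1 then a < 1 ≤ b, so a has an even
-- and b an odd denominator, which the parity argument forbids.
no-antipodal : (x y : D) → proj₁ y ≡ proj₁ x ℚ.+ 1ℚ → ⊥
no-antipodal (mkℚ -[1+ _ ] _ _ , ()) _ _
no-antipodal (mkℚ (+ _) _ _ , _) (mkℚ -[1+ _ ] _ _ , ()) _
no-antipodal (a@(mkℚ (+ p) d c) , a∈D) (b@(mkℚ (+ r) e c′) , b∈D) b≡a+1 =
  InD.upper-odd b-facts 1≤b
    (even-denominator-shift p (suc d) r (suc e) (recompute (coprime? p (suc d)) c)
       (InD.lower-even a-facts a≱1) (plus-one-cross p d r e c c′ b≡a+1))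
  where
    a-facts : InD a
    a-facts = inD⇒InD a a∈D

    b-facts : InD b
    b-facts = inD⇒InD b b∈D

    a≱1 : ¬ 1ℚ ℚ.≤ a
    a≱1 1≤a = InD.below-two b-facts
      (subst (two ℚ.≤_) (sym b≡a+1) (ℚP.+-mono-≤ 1≤a (ℚP.≤-refl {1ℚ})))

    1≤b : 1ℚ ℚ.≤ b
    1≤b = subst (1ℚ ℚ.≤_) (sym b≡a+1) (ℚP.+-mono-≤ (InD.nonnegative a-facts) (ℚP.≤-refl {1ℚ}))

D-≡ : (x y : D) → proj₁ x ≡ proj₁ y → x ≡ y
D-≡ (a , a∈D) (.a , a∈D′) refl = cong (a ,_) (T-irrelevant a∈D a∈D′)

-- A positive gap b - a gives the edge x → y if it is below 1 and y → x if it
-- exceeds 1; a gap of exactly 1 would make x, y antipodal.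
positive-gap : ∀ x y → 0ℚ ℚ.< proj₁ y - proj₁ x → S2E x y ⊎ S2E y x
positive-gap x@(a , _) y@(b , _) 0<b-a with ℚP.<-cmp (b - a) 1ℚ
... | tri< b-a<1 _ _ = inj₁ (inj₁ (0<b-a , b-a<1))
... | tri≈ _ b-a≡1 _ = ⊥-elim (no-antipodal x y (begin
        b               ≡⟨ //-rightDividesˡ a b ⟨
        (b - a) ℚ.+ a   ≡⟨ cong (ℚ._+ a) b-a≡1 ⟩
        1ℚ ℚ.+ a        ≡⟨ ℚP.+-comm 1ℚ a ⟩
        a ℚ.+ 1ℚ        ∎))
  where open ≡-Reasoning
... | tri> _ _ 1<b-a = inj₂ (inj₂ (subst (ℚ._< ℚ.- 1ℚ) (⁻¹-anti-homo‿- b a) (ℚP.neg-antimono-< 1<b-a)))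

-- S(2) is a tournament: the gap b - a between distinct points lies in (-2,2)
-- minus {-1, 0, 1}, and each of the remaining intervals gives one of the edges.
S2-tournament : TournamentReduct S2*
S2-tournament = record { _≟_ = _≟_ ; irreflexive = irreflexive ; total = total }
  where
    _≟_ : DecidableEquality D
    x ≟ y with proj₁ x ℚP.≟ proj₁ y
    ... | yes same-angle = yes (D-≡ x y same-angle)
    ... | no  diff-angle = no (diff-angle ∘ cong proj₁)

    irreflexive : ∀ x → ¬ S2E x x
    irreflexive (a , _) (inj₁ (0<a-a , _)) = ℚP.<-irrefl (sym (ℚP.+-inverseʳ a)) 0<a-a
    irreflexive (a , _) (inj₂ a-a<-1)      = -1≮0 (subst (ℚ._< ℚ.- 1ℚ) (ℚP.+-inverseʳ a) a-a<-1)
      where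
        -1≮0 : ¬ 0ℚ ℚ.< ℚ.- 1ℚ
        -1≮0 (ℚ.*<* ())

    total : ∀ x y → x ≢ y → S2E x y ⊎ S2E y x
    total x@(a , _) y@(b , _) x≢y with ℚP.<-cmp (b - a) 0ℚ
    ... | tri≈ _ b-a≡0 _ = ⊥-elim (x≢y (D-≡ x y (sym (x∙y⁻¹≈ε⇒x≈y b a b-a≡0))))
    ... | tri> _ _ 0<b-a = positive-gap x y 0<b-a
    ... | tri< b-a<0 _ _ =
          swap (positive-gap y x (subst (0ℚ ℚ.<_) (⁻¹-anti-homo‿- b a) (ℚP.neg-antimono-< b-a<0)))

tournamentReduct : (T : HomTournament) → TournamentReduct (T *)
tournamentReduct I₁             = I₁-tournament
tournamentReduct C₃             = C₃-tournament
tournamentReduct ℚT             = ℚ-tournament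
tournamentReduct S2             = S2-tournament
tournamentReduct (Tω M generic) = Tω-tournament M generic

-- Theorem 4.3: T* is a tournament and n ≥ 1 provides a label, so the main
-- lemma applies.
theorem4p3 : (T : HomTournament) (n : ℕ) → 1 ≤ n
           → ExpansionProperty (T *) → ExpansionProperty (blowup n (T *))
theorem4p3 T (suc n) _ = blowup-preserves-EP (tournamentReduct T) zero
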